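{- Let $G$ be a graph with $m$ edges and $n\ge 2$ vertices, and let $k$ and $r$ be positive integers. Then the integer $[x_1^r\cdots x_m^r]\,\widetilde\Psi_G^{kr}$ is divisible by $(kr)!/(r!)^k$.
   Context: Graphs are finite and undirected, and may have multiple edges and self-loops. The edges of $G$ are labelled $1,\dots,m$, with a variable $x_e$ for each edge. The Kirchhoff polynomial is $$\widetilde\Psi_G=\sum_T\prod_{e\in T}x_e\in\mathbb Z[x_1,\dots,x_m],$$ where the sum runs over all spanning trees $T$ of $G$, each viewed as a set of edges. For a polynomial $F$, $[x^m]F$ denotes the coefficient of the monomial $x^m$. -}

module Defs where

open import Data.Nat using (ℕ; zero; suc; _+_; _*_; _^_; _!; _∸_)
open import Data.Nat.Properties using (_!≢0; m^n≢0)
open import Data.Nat.DivMod using (_/_)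
open import Data.Fin using (Fin)
open import Data.Fin.Subset using (Subset; _∈_; _∉_)
open import Data.Bool using (Bool; true; false; _∧_; not; if_then_else_)
open import Data.Fin using (_≟_)
open import Relation.Nullary.Decidable using (⌊_⌋)
open import Data.Product using (_×_; _,_; proj₁; proj₂)
open import Data.Sum using (_⊎_)
open import Data.Vec using (Vec; replicate; zipWith; lookup; tabulate)
import Data.Vec.Properties as VecP
open import Data.List using (List; []; _∷_; map; concatMap; filter; length)
open import Data.List.Relation.Unary.Unique.Propositional using (Unique)
import Data.List.Membership.Propositional as LM
open import Relation.Binary.PropositionalEquality using (_≡_)
open import Relation.Nullary using (¬_)
open import Function.Bundles using (_⇔_)
import Data.Nat.Properties as ℕP

-- Graphs: finite, undirected, multiple edges and self-loops allowed.
-- Vertices are Fin n, edges are labelled by Fin m (edge i is "edge i+1"),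
-- each edge has an (unordered) pair of endpoints.

record Graph (n m : ℕ) : Set where
  field
    ends : Fin m → Fin n × Fin n

open Graph public

data Connected {n m : ℕ} (G : Graph n m) (S : Subset m) : Fin n → Fin n → Set where
  here  : ∀ {u} → Connected G S u u
  fwd   : ∀ {u v} (e : Fin m) → e ∈ S → proj₁ (ends G e) ≡ u →
          Connected G S (proj₂ (ends G e)) v → Connected G S u v
  bwd   : ∀ {u v} (e : Fin m) → e ∈ S → proj₂ (ends G e) ≡ u →
          Connected G S (proj₁ (ends G e)) v → Connected G S u v

_without_ : {m : ℕ} → Subset m → Fin m → Subset m
S without e = tabulate (λ f → lookup S f ∧ not ⌊ f ≟ e ⌋)

-- The edge set T forms a forest: no edge of T lies on a cycle of (V, T),
-- i.e. for each e ∈ T its endpoints are not joined in (V, T ∖ {e}).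
-- (A self-loop is a cycle; two parallel edges form a cycle.)
Acyclic : {n m : ℕ} → Graph n m → Subset m → Set
Acyclic G T = ∀ e → e ∈ T → ¬ Connected G (T without e) (proj₁ (ends G e)) (proj₂ (ends G e))

IsSpanningTree : {n m : ℕ} → Graph n m → Subset m → Set
IsSpanningTree G T = (∀ u v → Connected G T u v) × Acyclic G T

-- Polynomials in x_1..x_m with natural-number coefficients, represented
-- as finite formal sums of monomials (a list, i.e. multiset, of exponent
-- vectors; each entry contributes coefficient 1).

Monomial : ℕ → Set
Monomial m = Vec ℕ m

Poly : ℕ → Set
Poly m = List (Monomial m)

one : {m : ℕ} → Poly m
one = replicate _ 0 ∷ []

_·_ : {m : ℕ} → Poly m → Poly m → Poly m
p · q = concatMap (λ a → map (zipWith _+_ a) q) p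

_^ᴾ_ : {m : ℕ} → Poly m → ℕ → Poly m
p ^ᴾ zero  = one
p ^ᴾ suc k = p · (p ^ᴾ k)

coeff : {m : ℕ} → Monomial m → Poly m → ℕ
coeff a F = length (filter (λ b → VecP.≡-dec ℕP._≟_ b a) F)

edgeMonomial : {m : ℕ} → Subset m → Monomial m
edgeMonomial T = tabulate (λ e → if lookup T e then 1 else 0)

-- Kirchhoff polynomial Σ_T ∏_{e∈T} x_e, given the list of all spanning
-- trees (each listed exactly once).
kirchhoff : {m : ℕ} → List (Subset m) → Poly m
kirchhoff ts = map edgeMonomial ts

EnumeratesSpanningTrees : {n m : ℕ} → Graph n m → List (Subset m) → Set
EnumeratesSpanningTrees G ts = Unique ts × (∀ T → (T LM.∈ ts) ⇔ IsSpanningTree G T)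

multinomialQuot : ℕ → ℕ → ℕ
multinomialQuot k r = ((k * r) !) / ((r !) ^ k)
  where instance _ = m^n≢0 (r !) k {{r !≢0}}

{-# OPTIONS --safe #-}

-- Let T_1, …, T_t be the spanning trees, N = kr and D = (kr)!/(r!)^k, so that N! = D (r!)^k.
-- The substitution y_j ↦ x^(T_j) maps (y_1 + ⋯ + y_t)^N onto Ψ^N, so the coefficient of
-- (x_1 ⋯ x_m)^r in Ψ^N is a sum of multinomial coefficients N!/∏_j c_j! over the exponent
-- vectors c with |c| = N mapped to (r, …, r); it suffices that ∏_j c_j! divides (r!)^k.
-- For each edge e we have ∑_{j : e ∈ T_j} c_j = r, so ∏_{j : e ∈ T_j} c_j! divides r!.
-- Taking the product over all edges, and using that every tree has n − 1 edges, gives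
-- (∏_j c_j!)^(n−1) ∣ (r!)^m, and double counting the pairs (e, j) with e ∈ T_j gives
-- m r = N (n − 1), i.e. (r!)^m = ((r!)^k)^(n−1). Finally a^(n−1) ∣ b^(n−1) implies a ∣ b.
-- That a spanning tree has n − 1 edges follows by running union–find along its edges:
-- by acyclicity each edge merges two distinct classes, and at the end one class remains.

module Submission where

open import Defs
open import Data.Nat hiding (_≟_)
open import Data.Nat.Properties hiding (_≟_)
import Data.Nat.Properties as ℕ
open import Data.Nat.Divisibility
open import Data.Nat.DivMod using (m/n*n≡m)
open import Data.Nat.Combinatorics using (k![n∸k]!∣n!)
open import Data.Nat.GCD using (gcd; GCD; gcd-GCD; gcd[m,n]∣m; gcd[m,n]∣n; gcd[m,n]≢0; GCD-*)
open import Data.Nat.Coprimality using (Coprime; GCD≡1⇒coprime; coprime-divisor)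
open import Data.Bool using (true; false; _∧_; not; if_then_else_)
open import Data.Fin using (Fin; zero; suc; _≟_; punchIn; fromℕ<)
open import Data.Fin.Properties using (punchInᵢ≢i; any?)
import Data.Fin.Properties as Fin
open import Data.Fin.Subset using (Subset; _∈_)
open import Data.Vec using ([]; _∷_; replicate; zipWith; lookup; tabulate; _[_]≔_; here; there)
open import Data.Vec.Properties
  using (≡-dec; lookup∘tabulate; tabulate∘lookup; tabulate-cong; lookup-zipWith; lookup-replicate;
         lookup∘update; lookup∘update′; []=⇒lookup; lookup⇒[]=)
open import Data.List using (List; []; _∷_; map; concatMap; filter; length; _++_)
import Data.List as List
open import Data.List.Properties
  using (length-++; length-filter; length-map; filter-++; filter-reject; map-++; map-∘; map-cong; map-tabulate; tabulate-lookup)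
  renaming (tabulate-cong to List-tabulate-cong)
open import Data.List.Membership.Propositional using () renaming (_∈_ to _∈ₗ_)
open import Data.List.Membership.Propositional.Properties using (∈-map⁺; ∈-map⁻; ∈-lookup)
open import Data.List.Relation.Unary.Any using (here; there)
import Data.List.Relation.Unary.All as All
open import Data.List.Relation.Unary.Unique.Propositional using (Unique; []; _∷_)
open import Data.List.Relation.Unary.Unique.Propositional.Properties using (map⁺)
open import Data.Product using (_,_; proj₁; proj₂; ∃)
open import Data.Sum using (inj₁)
open import Relation.Nullary using (yes; no; ¬_; Dec; ¬?; contradiction)
open import Relation.Nullary.Decidable using (isYes; dec-false; isYes≗does)
open import Relation.Binary.PropositionalEquality
  using (_≡_; _≢_; refl; sym; trans; cong; cong₂; subst; subst₂; module ≡-Reasoning)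
open import Function using (_∘_; id; _⇔_; mk⇔; Equivalence)
open import Algebra.Bundles using (CommutativeMonoid)
import Algebra.Properties.CommutativeMonoid.Sum as MonoidSum
import Algebra.Properties.CommutativeSemigroup as SemigroupProperties
import Relation.Binary.Reasoning.Setoid as SetoidReasoning
open import Algebra.Properties.CommutativeSemigroup *-commutativeSemigroup
  using (x∙yz≈y∙xz; xy∙z≈xz∙y) renaming (interchange to *-interchange)
open import Algebra.Properties.Semiring.Sum +-*-semiring
  using (sum; sum-cong-≗; ∑-distrib-+; ∑-comm; *-distribˡ-sum; *-distribʳ-sum; sum-replicate-zero)
import Algebra.Properties.CommutativeMonoid.Sum *-1-commutativeMonoid as Product
open Product using ()
  renaming (sum-cong-≗ to ∏-cong; sum-replicate-zero to ∏-replicate-one; ∑-distrib-+ to ∏-distrib-*; ∑-comm to ∏-comm)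

∏ : ∀ {n} → (Fin n → ℕ) → ℕ
∏ = Product.sum

module _ {a ℓ} (M : CommutativeMonoid a ℓ) where
  open CommutativeMonoid M
  open MonoidSum M using (sum-cong-≋) renaming (sum to ∑ᴹ; sum-remove to ∑ᴹ-remove)
  open SemigroupProperties commutativeSemigroup using (xy∙z≈zy∙x)
  open SetoidReasoning setoid

  sum-update : ∀ {n} (f g : Fin n → Carrier) j → (∀ i → i ≢ j → f i ≈ g i) → ∑ᴹ f ∙ g j ≈ ∑ᴹ g ∙ f j
  sum-update {suc n} f g j f≈g = begin
    ∑ᴹ f ∙ g j                                  ≈⟨ ∙-congʳ (∑ᴹ-remove {i = j} f) ⟩
    (f j ∙ ∑ᴹ (λ i → f (punchIn j i))) ∙ g j    ≈⟨ ∙-congʳ (∙-congˡ (sum-cong-≋ λ i → f≈g _ (punchInᵢ≢i j i))) ⟩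
    (f j ∙ ∑ᴹ (λ i → g (punchIn j i))) ∙ g j    ≈⟨ xy∙z≈zy∙x _ _ _ ⟩
    (g j ∙ ∑ᴹ (λ i → g (punchIn j i))) ∙ f j    ≈⟨ ∙-congʳ (∑ᴹ-remove {i = j} g) ⟨
    ∑ᴹ g ∙ f j                                  ∎

∑-update : ∀ {n} (f g : Fin n → ℕ) j → (∀ i → i ≢ j → f i ≡ g i) → sum f + g j ≡ sum g + f j
∑-update = sum-update +-0-commutativeMonoid

∏-update : ∀ {n} (f g : Fin n → ℕ) j → (∀ i → i ≢ j → f i ≡ g i) → ∏ f * g j ≡ ∏ g * f j
∏-update = sum-update *-1-commutativeMonoid

open ≡-Reasoning

∑-const : ∀ n c → sum {n} (λ _ → c) ≡ n * c
∑-const zero    c = refl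
∑-const (suc n) c = cong (c +_) (∑-const n c)

∏-const : ∀ n c → ∏ {n} (λ _ → c) ≡ c ^ n
∏-const zero    c = refl
∏-const (suc n) c = cong (c *_) (∏-const n c)

∏-pow : ∀ {n} a (f : Fin n → ℕ) → ∏ (λ i → a ^ f i) ≡ a ^ sum f
∏-pow {zero}  a f = refl
∏-pow {suc n} a f = trans (cong (a ^ f zero *_) (∏-pow a (f ∘ suc))) (sym (^-distribˡ-+-* a (f zero) _))

∏-^ : ∀ {n} (f : Fin n → ℕ) s → ∏ (λ i → f i ^ s) ≡ ∏ f ^ s
∏-^ {n} f zero    = ∏-replicate-one n
∏-^     f (suc s) = trans (∏-distrib-* f (λ i → f i ^ s)) (cong (∏ f *_) (∏-^ f s))

∏-mono-∣ : ∀ {n} {f g : Fin n → ℕ} → (∀ i → f i ∣ g i) → ∏ f ∣ ∏ g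
∏-mono-∣ {zero}  f∣g = ∣-refl
∏-mono-∣ {suc n} f∣g = *-pres-∣ (f∣g zero) (∏-mono-∣ (f∣g ∘ suc))

sum-single : ∀ {n} (f : Fin n → ℕ) j → (∀ i → i ≢ j → f i ≡ 0) → sum f ≡ f j
sum-single {suc n} f j f≡0 = begin
  sum f                              ≡⟨ MonoidSum.sum-remove +-0-commutativeMonoid {i = j} f ⟩
  f j + sum (λ i → f (punchIn j i))  ≡⟨ cong (f j +_) (sum-cong-≗ (λ i → f≡0 _ (punchInᵢ≢i j i))) ⟩
  f j + sum {n} (λ _ → 0)            ≡⟨ cong (f j +_) (sum-replicate-zero n) ⟩
  f j + 0                            ≡⟨ +-identityʳ (f j) ⟩
  f j                                ∎

sum≡0⇒≡0 : ∀ {n} (f : Fin n → ℕ) → sum f ≡ 0 → ∀ i → f i ≡ 0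
sum≡0⇒≡0 f ∑f≡0 zero    = m+n≡0⇒m≡0 (f zero) ∑f≡0
sum≡0⇒≡0 f ∑f≡0 (suc i) = sum≡0⇒≡0 (f ∘ suc) (m+n≡0⇒n≡0 (f zero) ∑f≡0) i

indicator : ∀ {P : Set} → Dec P → ℕ
indicator (yes _) = 1
indicator (no  _) = 0

indicator-yes : ∀ {P : Set} {P? : Dec P} → P → indicator P? ≡ 1
indicator-yes {P? = yes _} _ = refl
indicator-yes {P? = no ¬p} p = contradiction p ¬p

indicator-no : ∀ {P : Set} {P? : Dec P} → ¬ P → indicator P? ≡ 0
indicator-no {P? = yes p} ¬p = contradiction p ¬p
indicator-no {P? = no  _} _  = refl

indicator-⇔ : ∀ {P Q : Set} {P? : Dec P} {Q? : Dec Q} → P ⇔ Q → indicator P? ≡ indicator Q?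
indicator-⇔ {Q? = Q?} P⇔Q with Q?
... | yes q = indicator-yes (Equivalence.from P⇔Q q)
... | no ¬q = indicator-no (¬q ∘ Equivalence.to P⇔Q)

m!*n!∣[m+n]! : ∀ m n → m ! * n ! ∣ (m + n) !
m!*n!∣[m+n]! m n = subst (λ k → m ! * k ! ∣ (m + n) !) (m+n∸m≡n m n) (k![n∸k]!∣n! (m≤m+n m n))

∏!∣∑! : ∀ {n} (f : Fin n → ℕ) → ∏ (λ i → f i !) ∣ sum f !
∏!∣∑! {zero}  f = ∣-refl
∏!∣∑! {suc n} f = ∣-trans (*-monoʳ-∣ (f zero !) (∏!∣∑! (f ∘ suc))) (m!*n!∣[m+n]! (f zero) (sum (f ∘ suc)))

[n!]^b≡[n*b]! : ∀ n {b} → b ≤ 1 → (n !) ^ b ≡ (n * b) !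
[n!]^b≡[n*b]! n z≤n       = cong _! (sym (*-zeroʳ n))
[n!]^b≡[n*b]! n (s≤s z≤n) = trans (*-identityʳ (n !)) (cong _! (sym (*-identityʳ n)))

multinomialQuot*[r!]^k≡[k*r]! : ∀ k r → multinomialQuot k r * (r !) ^ k ≡ (k * r) !
multinomialQuot*[r!]^k≡[k*r]! k r = m/n*n≡m {{m^n≢0 (r !) k {{r !≢0}}}}
  (subst₂ _∣_ (∏-const k (r !)) (cong _! (∑-const k r)) (∏!∣∑! {k} λ _ → r))

^-distribʳ-* : ∀ m n o → (m * n) ^ o ≡ m ^ o * n ^ o
^-distribʳ-* m n zero    = refl
^-distribʳ-* m n (suc o) = begin
  m * n * (m * n) ^ o       ≡⟨ cong (m * n *_) (^-distribʳ-* m n o) ⟩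
  m * n * (m ^ o * n ^ o)   ≡⟨ *-interchange m n (m ^ o) (n ^ o) ⟩
  m * m ^ o * (n * n ^ o)   ∎

coprime∧∣^⇒∣1 : ∀ {a b} → Coprime a b → ∀ j → a ∣ b ^ j → a ∣ 1
coprime∧∣^⇒∣1 cop zero    a∣1    = a∣1
coprime∧∣^⇒∣1 cop (suc j) a∣b^1+j = coprime∧∣^⇒∣1 cop j (coprime-divisor cop a∣b^1+j)

-- Write m = a g and o = b g with g = gcd m o; then a ∣ b ^ (1 + n) with a, b coprime, so a = 1.
m^[1+n]∣o^[1+n]⇒m∣o : ∀ n m o → m ^ suc n ∣ o ^ suc n → m ∣ o
m^[1+n]∣o^[1+n]⇒m∣o n zero o 0∣o^[1+n] with m^n≡0⇒m≡0 o (suc n) (0∣⇒≡0 0∣o^[1+n])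
... | refl = ∣-refl
m^[1+n]∣o^[1+n]⇒m∣o n m@(suc _) o m^[1+n]∣o^[1+n] = subst (_∣ o) (sym m≡g) (gcd[m,n]∣n m o)
  where
  g = gcd m o
  instance
    g≢0 : NonZero g
    g≢0 = ≢-nonZero (gcd[m,n]≢0 m o (inj₁ λ ()))
    gⁿ≢0 : NonZero (g ^ suc n)
    gⁿ≢0 = m^n≢0 g (suc n)
  a = quotient (gcd[m,n]∣m m o)
  b = quotient (gcd[m,n]∣n m o)
  m≡ag : m ≡ a * g
  m≡ag = _∣_.equality (gcd[m,n]∣m m o)
  o≡bg : o ≡ b * g
  o≡bg = _∣_.equality (gcd[m,n]∣n m o)
  a⊥b : Coprime a b
  a⊥b = GCD≡1⇒coprime (GCD-* (subst₂ (λ x y → GCD x y (1 * g)) m≡ag o≡bg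
          (subst (GCD m o) (sym (*-identityˡ g)) (gcd-GCD m o))))
  aⁿgⁿ∣bⁿgⁿ : a ^ suc n * g ^ suc n ∣ b ^ suc n * g ^ suc n
  aⁿgⁿ∣bⁿgⁿ = subst₂ _∣_ (trans (cong (_^ suc n) m≡ag) (^-distribʳ-* a g (suc n)))
                        (trans (cong (_^ suc n) o≡bg) (^-distribʳ-* b g (suc n))) m^[1+n]∣o^[1+n]
  a≡1 : a ≡ 1
  a≡1 = ∣1⇒≡1 (coprime∧∣^⇒∣1 a⊥b (suc n)
          (∣-trans (m∣m*n (a ^ n)) (*-cancelʳ-∣ (g ^ suc n) aⁿgⁿ∣bⁿgⁿ)))
  m≡g : m ≡ g
  m≡g = trans m≡ag (trans (cong (_* g) a≡1) (*-identityˡ g))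

m*n≡o*p⇒n∣p⇒o∣m : ∀ {m n o p} .{{_ : NonZero p}} → m * n ≡ o * p → n ∣ p → o ∣ m
m*n≡o*p⇒n∣p⇒o∣m {m} {n} {o} {p} mn≡op (divides q p≡qn) = divides q (*-cancelʳ-≡ m (q * o) n {{n≢0}} (begin
  m * n        ≡⟨ mn≡op ⟩
  o * p        ≡⟨ cong (o *_) p≡qn ⟩
  o * (q * n)  ≡⟨ *-assoc o q n ⟨
  o * q * n    ≡⟨ cong (_* n) (*-comm o q) ⟩
  q * o * n    ∎))
  where
  n≢0 : NonZero n
  n≢0 = ≢-nonZero λ { refl → ≢-nonZero⁻¹ p (trans p≡qn (*-zeroʳ q)) }

_≟ᵛ_ : ∀ {t} (u v : Monomial t) → Dec (u ≡ v)
_≟ᵛ_ = ≡-dec ℕ._≟_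

_+ᵛ_ : ∀ {t} → Monomial t → Monomial t → Monomial t
_+ᵛ_ = zipWith _+_

lookup-+ᵛ : ∀ {t} (u v : Monomial t) i → lookup (u +ᵛ v) i ≡ lookup u i + lookup v i
lookup-+ᵛ u v i = lookup-zipWith _+_ i u v

vec-ext : ∀ {t} {u v : Monomial t} → (∀ i → lookup u i ≡ lookup v i) → u ≡ v
vec-ext {u = u} {v} u≗v = trans (sym (tabulate∘lookup u)) (trans (tabulate-cong u≗v) (tabulate∘lookup v))

+ᵛ-cancelˡ : ∀ {t} (u : Monomial t) {v w} → u +ᵛ v ≡ u +ᵛ w → v ≡ w
+ᵛ-cancelˡ u {v} {w} u+v≡u+w = vec-ext λ i → +-cancelˡ-≡ (lookup u i) (lookup v i) (lookup w i)
  (trans (sym (lookup-+ᵛ u v i)) (trans (cong (λ x → lookup x i) u+v≡u+w) (lookup-+ᵛ u w i)))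

coeff-++ : ∀ {t} (a : Monomial t) p q → coeff a (p ++ q) ≡ coeff a p + coeff a q
coeff-++ a p q = trans (cong length (filter-++ (_≟ᵛ a) p q)) (length-++ (filter (_≟ᵛ a) p))

coeff-here : ∀ {t} (a : Monomial t) p → coeff a (a ∷ p) ≡ suc (coeff a p)
coeff-here a p with a ≟ᵛ a
... | yes _  = refl
... | no a≢a = contradiction refl a≢a

coeff-there : ∀ {t} {a b : Monomial t} p → b ≢ a → coeff a (b ∷ p) ≡ coeff a p
coeff-there {a = a} {b} p b≢a with b ≟ᵛ a
... | yes b≡a = contradiction b≡a b≢a
... | no _    = refl

module _ {s t} (f : Monomial s → Monomial t) where

  coeff-map-fibre-empty : ∀ a → (∀ y → f y ≢ a) → ∀ p → coeff a (map f p) ≡ 0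
  coeff-map-fibre-empty a no-fibre []      = refl
  coeff-map-fibre-empty a no-fibre (y ∷ p) =
    trans (coeff-there (map f p) (no-fibre y)) (coeff-map-fibre-empty a no-fibre p)

  coeff-map-fibre-single : ∀ a b → (∀ y → f y ≡ a ⇔ y ≡ b) → ∀ p → coeff a (map f p) ≡ coeff b p
  coeff-map-fibre-single a b fibre []      = refl
  coeff-map-fibre-single a b fibre (y ∷ p) with y ≟ᵛ b
  ... | yes refl = trans (cong (λ z → coeff a (z ∷ map f p)) (Equivalence.from (fibre y) refl))
                         (trans (coeff-here a (map f p)) (cong suc (coeff-map-fibre-single a b fibre p)))
  ... | no y≢b   = trans (coeff-there (map f p) (y≢b ∘ Equivalence.to (fibre y)))
                         (coeff-map-fibre-single a b fibre p)

deleteAll : ∀ {t} → Monomial t → Poly t → Poly t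
deleteAll u = filter (λ y → ¬? (y ≟ᵛ u))

length-deleteAll-∷ : ∀ {t} (u : Monomial t) p → length (deleteAll u (u ∷ p)) ≤ length p
length-deleteAll-∷ u p = ≤-trans (≤-reflexive (cong length (filter-reject (λ y → ¬? (y ≟ᵛ u)) λ u≢u → u≢u refl)))
                                 (length-filter _ p)

coeff-deleteAll-≡ : ∀ {t} (u : Monomial t) p → coeff u (deleteAll u p) ≡ 0
coeff-deleteAll-≡ u []      = refl
coeff-deleteAll-≡ u (y ∷ p) with y ≟ᵛ u
... | yes _  = coeff-deleteAll-≡ u p
... | no y≢u = trans (coeff-there (deleteAll u p) y≢u) (coeff-deleteAll-≡ u p)

coeff-deleteAll-≢ : ∀ {t} {u v : Monomial t} → v ≢ u → ∀ p → coeff v (deleteAll u p) ≡ coeff v p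
coeff-deleteAll-≢         v≢u []      = refl
coeff-deleteAll-≢ {u = u} {v} v≢u (y ∷ p) with y ≟ᵛ u
... | yes refl = trans (coeff-deleteAll-≢ v≢u p) (sym (coeff-there p (v≢u ∘ sym)))
... | no _ with y ≟ᵛ v
...   | yes _ = cong suc (coeff-deleteAll-≢ v≢u p)
...   | no _  = coeff-deleteAll-≢ v≢u p

module _ {s t} (f : Monomial s → Monomial t) (a : Monomial t) where

  coeff-map-deleteAll : ∀ u → f u ≡ a → ∀ p → coeff a (map f p) ≡ coeff u p + coeff a (map f (deleteAll u p))
  coeff-map-deleteAll u fu≡a []      = refl
  coeff-map-deleteAll u fu≡a (y ∷ p) with y ≟ᵛ u
  ... | yes refl = trans (cong (λ z → coeff a (z ∷ map f p)) fu≡a)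
                         (trans (coeff-here a (map f p)) (cong suc (coeff-map-deleteAll u fu≡a p)))
  ... | no _ with f y ≟ᵛ a
  ...   | yes _ = trans (cong suc (coeff-map-deleteAll u fu≡a p)) (sym (+-suc _ _))
  ...   | no _  = coeff-map-deleteAll u fu≡a p

  coeff-map-deleteAll-≢ : ∀ u → f u ≢ a → ∀ p → coeff a (map f p) ≡ coeff a (map f (deleteAll u p))
  coeff-map-deleteAll-≢ u fu≢a []      = refl
  coeff-map-deleteAll-≢ u fu≢a (y ∷ p) with y ≟ᵛ u
  ... | yes refl = trans (coeff-there (map f p) fu≢a) (coeff-map-deleteAll-≢ u fu≢a p)
  ... | no _ with f y ≟ᵛ a
  ...   | yes _ = cong suc (coeff-map-deleteAll-≢ u fu≢a p)
  ...   | no _  = coeff-map-deleteAll-≢ u fu≢a p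

  -- Grouping p by monomials: every u in the fibre of a contributes coeff u p.
  -- The recursive call is on deleteAll u (u ∷ p), hence the fuel.
  coeff-map-∣ : ∀ {d} p → (∀ u → f u ≡ a → d ∣ coeff u p) → d ∣ coeff a (map f p)
  coeff-map-∣ {d} p = go (length p) p ≤-refl
    where
    go : ∀ fuel p → length p ≤ fuel → (∀ u → f u ≡ a → d ∣ coeff u p) → d ∣ coeff a (map f p)
    go _          []      _          _         = d ∣0
    go (suc fuel) (u ∷ p) (s≤s |p|≤) d∣fibres = split (f u ≟ᵛ a)
      where
      rest = deleteAll u (u ∷ p)
      d∣rest-fibres : ∀ v → f v ≡ a → d ∣ coeff v rest
      d∣rest-fibres v fv≡a with v ≟ᵛ u
      ... | yes refl = subst (d ∣_) (sym (coeff-deleteAll-≡ u (u ∷ p))) (d ∣0)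
      ... | no  v≢u  = subst (d ∣_) (sym (coeff-deleteAll-≢ v≢u (u ∷ p))) (d∣fibres v fv≡a)
      d∣rest : d ∣ coeff a (map f rest)
      d∣rest = go fuel rest (≤-trans (length-deleteAll-∷ u p) |p|≤) d∣rest-fibres
      split : Dec (f u ≡ a) → d ∣ coeff a (map f (u ∷ p))
      split (yes fu≡a) = subst (d ∣_) (sym (coeff-map-deleteAll u fu≡a (u ∷ p)))
                                       (∣m∣n⇒∣m+n (d∣fibres u fu≡a) d∣rest)
      split (no  fu≢a) = subst (d ∣_) (sym (coeff-map-deleteAll-≢ u fu≢a (u ∷ p))) d∣rest

module _ {s t} (f : Monomial s → Monomial t)
         (f-+ᵛ : ∀ u v → f (u +ᵛ v) ≡ f u +ᵛ f v) (f-0 : f (replicate s 0) ≡ replicate t 0) where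

  map-· : ∀ p q → map f (p · q) ≡ map f p · map f q
  map-· []      q = refl
  map-· (u ∷ p) q = trans (map-++ f (map (u +ᵛ_) q) (p · q)) (cong₂ _++_
    (trans (sym (map-∘ q)) (trans (map-cong (f-+ᵛ u) q) (map-∘ q))) (map-· p q))

  map-^ᴾ : ∀ p N → map f (p ^ᴾ N) ≡ map f p ^ᴾ N
  map-^ᴾ p zero    = cong (_∷ []) f-0
  map-^ᴾ p (suc N) = trans (map-· p (p ^ᴾ N)) (cong (map f p ·_) (map-^ᴾ p N))

-- The multinomial theorem

unit : ∀ {t} → Fin t → Monomial t
unit j = replicate _ 0 [ j ]≔ 1

lookup-unit-≡ : ∀ {t} (j : Fin t) → lookup (unit j) j ≡ 1
lookup-unit-≡ j = lookup∘update j (replicate _ 0) 1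

lookup-unit-≢ : ∀ {t} {i j : Fin t} → i ≢ j → lookup (unit j) i ≡ 0
lookup-unit-≢ {i = i} i≢j = trans (lookup∘update′ i≢j (replicate _ 0) 1) (lookup-replicate i 0)

variableSum : ∀ t → Poly t
variableSum t = List.tabulate unit

degree : ∀ {t} → Monomial t → ℕ
degree c = sum (lookup c)

∏! : ∀ {t} → Monomial t → ℕ
∏! c = ∏ (λ i → lookup c i !)

degree-replicate : ∀ m r → degree (replicate m r) ≡ m * r
degree-replicate m r = trans (sum-cong-≗ {m} {lookup (replicate m r)} (λ e → lookup-replicate e r)) (∑-const m r)

∏!-replicate-0 : ∀ t → ∏! (replicate t 0) ≡ 1
∏!-replicate-0 t = trans (∏-cong {t} {λ i → lookup (replicate t 0) i !} (λ i → cong _! (lookup-replicate i 0)))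
                         (∏-replicate-one t)

degree≡0⇒≡0 : ∀ {t} (c : Monomial t) → degree c ≡ 0 → c ≡ replicate t 0
degree≡0⇒≡0 c deg≡0 = vec-ext λ i → trans (sum≡0⇒≡0 (lookup c) deg≡0 i) (sym (lookup-replicate i 0))

coeff-concatMap-tabulate : ∀ {r t} {A : Set} (a : Monomial t) (h : Fin r → A) (g : A → Poly t) →
  coeff a (concatMap g (List.tabulate h)) ≡ sum (λ j → coeff a (g (h j)))
coeff-concatMap-tabulate {zero}  a h g = refl
coeff-concatMap-tabulate {suc r} a h g = trans (coeff-++ a (g (h zero)) _)
  (cong (coeff a (g (h zero)) +_) (coeff-concatMap-tabulate a (h ∘ suc) g))

coeff-variableSum-· : ∀ {t} (c : Monomial t) q →
  coeff c (variableSum t · q) ≡ sum (λ j → coeff c (map (unit j +ᵛ_) q))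
coeff-variableSum-· c q = coeff-concatMap-tabulate c unit (λ u → map (u +ᵛ_) q)

module _ {t} (j : Fin t) (c : Monomial t) where

  coeff-shift-0 : lookup c j ≡ 0 → ∀ q → coeff c (map (unit j +ᵛ_) q) ≡ 0
  coeff-shift-0 cⱼ≡0 = coeff-map-fibre-empty (unit j +ᵛ_) c λ y e+y≡c → 0≢1+n (begin
    0                               ≡⟨ cⱼ≡0 ⟨
    lookup c j                      ≡⟨ cong (λ v → lookup v j) e+y≡c ⟨
    lookup (unit j +ᵛ y) j          ≡⟨ lookup-+ᵛ (unit j) y j ⟩
    lookup (unit j) j + lookup y j  ≡⟨ cong (_+ lookup y j) (lookup-unit-≡ j) ⟩
    suc (lookup y j)                ∎)

  module _ {p} (cⱼ≡1+p : lookup c j ≡ suc p) where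

    private
      c⁻ : Monomial t
      c⁻ = c [ j ]≔ p

      lookup-c⁻-≢ : ∀ {i} → i ≢ j → lookup c⁻ i ≡ lookup c i
      lookup-c⁻-≢ i≢j = lookup∘update′ i≢j c p

    unit+c⁻≡c : unit j +ᵛ c⁻ ≡ c
    unit+c⁻≡c = vec-ext λ i → trans (lookup-+ᵛ (unit j) c⁻ i) (at (i ≟ j))
      where
      at : ∀ {i} → Dec (i ≡ j) → lookup (unit j) i + lookup c⁻ i ≡ lookup c i
      at (yes refl) = trans (cong₂ _+_ (lookup-unit-≡ j) (lookup∘update j c p)) (sym cⱼ≡1+p)
      at (no i≢j)   = cong₂ _+_ (lookup-unit-≢ i≢j) (lookup-c⁻-≢ i≢j)

    coeff-shift-suc : ∀ q → coeff c (map (unit j +ᵛ_) q) ≡ coeff c⁻ q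
    coeff-shift-suc = coeff-map-fibre-single (unit j +ᵛ_) c c⁻ λ y → mk⇔
      (λ e+y≡c → +ᵛ-cancelˡ (unit j) (trans e+y≡c (sym unit+c⁻≡c)))
      (λ { refl → unit+c⁻≡c })

    degree-shift : degree c ≡ suc (degree c⁻)
    degree-shift = +-cancelʳ-≡ p (degree c) (suc (degree c⁻)) (begin
      degree c + p                ≡⟨ cong (degree c +_) (lookup∘update j c p) ⟨
      degree c + lookup c⁻ j      ≡⟨ ∑-update (lookup c) (lookup c⁻) j (λ _ i≢j → sym (lookup-c⁻-≢ i≢j)) ⟩
      degree c⁻ + lookup c j      ≡⟨ cong (degree c⁻ +_) cⱼ≡1+p ⟩
      degree c⁻ + suc p           ≡⟨ +-suc (degree c⁻) p ⟩
      suc (degree c⁻) + p         ∎)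

    ∏!-shift : ∏! c ≡ suc p * ∏! c⁻
    ∏!-shift = *-cancelʳ-≡ (∏! c) (suc p * ∏! c⁻) (p !) {{p !≢0}} (begin
      ∏! c * p !                  ≡⟨ cong (λ x → ∏! c * x !) (lookup∘update j c p) ⟨
      ∏! c * lookup c⁻ j !        ≡⟨ ∏-update (λ i → lookup c i !) (λ i → lookup c⁻ i !) j
                                         (λ _ i≢j → cong _! (sym (lookup-c⁻-≢ i≢j))) ⟩
      ∏! c⁻ * lookup c j !        ≡⟨ cong (λ x → ∏! c⁻ * x !) cⱼ≡1+p ⟩
      ∏! c⁻ * (suc p * p !)       ≡⟨ *-assoc (∏! c⁻) (suc p) (p !) ⟨
      ∏! c⁻ * suc p * p !         ≡⟨ cong (_* p !) (*-comm (∏! c⁻) (suc p)) ⟩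
      suc p * ∏! c⁻ * p !         ∎)

multinomial : ∀ {t} N (c : Monomial t) → degree c ≡ N → coeff c (variableSum t ^ᴾ N) * ∏! c ≡ N !
multinomial {t} zero c deg≡0 with degree≡0⇒≡0 c deg≡0
... | refl = cong₂ _*_ (coeff-here c []) (∏!-replicate-0 t)
multinomial {t} (suc N) c deg≡1+N = begin
  coeff c (variableSum t ^ᴾ suc N) * ∏! c           ≡⟨ cong (_* ∏! c) (coeff-variableSum-· c Yᴺ) ⟩
  sum (λ j → coeff c (map (unit j +ᵛ_) Yᴺ)) * ∏! c  ≡⟨ *-distribʳ-sum (∏! c) (λ j → coeff c (map (unit j +ᵛ_) Yᴺ)) ⟩
  sum (λ j → coeff c (map (unit j +ᵛ_) Yᴺ) * ∏! c)  ≡⟨ sum-cong-≗ term ⟩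
  sum (λ j → lookup c j * N !)                      ≡⟨ *-distribʳ-sum (N !) (lookup c) ⟨
  degree c * N !                                    ≡⟨ cong (_* N !) deg≡1+N ⟩
  suc N * N !                                       ∎
  where
  Yᴺ = variableSum t ^ᴾ N
  term : ∀ j → coeff c (map (unit j +ᵛ_) Yᴺ) * ∏! c ≡ lookup c j * N !
  term j with lookup c j in cⱼ≡
  ... | zero  = cong (_* ∏! c) (coeff-shift-0 j c cⱼ≡ Yᴺ)
  ... | suc p = begin
    coeff c (map (unit j +ᵛ_) Yᴺ) * ∏! c  ≡⟨ cong₂ _*_ (coeff-shift-suc j c cⱼ≡ Yᴺ) (∏!-shift j c cⱼ≡) ⟩
    coeff c⁻ Yᴺ * (suc p * ∏! c⁻)         ≡⟨ x∙yz≈y∙xz (coeff c⁻ Yᴺ) (suc p) (∏! c⁻) ⟩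
    suc p * (coeff c⁻ Yᴺ * ∏! c⁻)         ≡⟨ cong (suc p *_) (multinomial N c⁻ deg-c⁻) ⟩
    suc p * N !                           ∎
    where
    c⁻ = c [ j ]≔ p
    deg-c⁻ : degree c⁻ ≡ N
    deg-c⁻ = suc-injective (trans (sym (degree-shift j c cⱼ≡)) deg≡1+N)

multinomial-≢ : ∀ {t} N (c : Monomial t) → degree c ≢ N → coeff c (variableSum t ^ᴾ N) ≡ 0
multinomial-≢ {t} zero c deg≢0 = coeff-there [] 0≢c
  where
  0≢c : replicate t 0 ≢ c
  0≢c refl = deg≢0 (trans (degree-replicate t 0) (*-zeroʳ t))
multinomial-≢ {t} (suc N) c deg≢1+N =
  trans (coeff-variableSum-· c Yᴺ) (trans (sum-cong-≗ term) (sum-replicate-zero t))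
  where
  Yᴺ = variableSum t ^ᴾ N
  term : ∀ j → coeff c (map (unit j +ᵛ_) Yᴺ) ≡ 0
  term j with lookup c j in cⱼ≡
  ... | zero  = coeff-shift-0 j c cⱼ≡ Yᴺ
  ... | suc p = trans (coeff-shift-suc j c cⱼ≡ Yᴺ)
                      (multinomial-≢ N (c [ j ]≔ p) (deg≢1+N ∘ trans (degree-shift j c cⱼ≡) ∘ cong suc))

-- Substituting monomials for the variables

module _ {t m} (M : Fin t → Monomial m) where

  contribution : Monomial t → Fin m → Fin t → ℕ
  contribution c e j = lookup c j * lookup (M j) e

  -- The image of y^c under the substitution y_j ↦ x^(M j).
  substitute : Monomial t → Monomial m
  substitute c = tabulate λ e → sum (contribution c e)

  lookup-substitute : ∀ c e → lookup (substitute c) e ≡ sum (contribution c e)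
  lookup-substitute c e = lookup∘tabulate _ e

  substitute-+ᵛ : ∀ u v → substitute (u +ᵛ v) ≡ substitute u +ᵛ substitute v
  substitute-+ᵛ u v = vec-ext λ e → begin
    lookup (substitute (u +ᵛ v)) e                         ≡⟨ lookup-substitute (u +ᵛ v) e ⟩
    sum (contribution (u +ᵛ v) e)                          ≡⟨ sum-cong-≗ (contribution-+ᵛ e) ⟩
    sum (λ j → contribution u e j + contribution v e j)    ≡⟨ ∑-distrib-+ (contribution u e) (contribution v e) ⟩
    sum (contribution u e) + sum (contribution v e)        ≡⟨ cong₂ _+_ (lookup-substitute u e) (lookup-substitute v e) ⟨
    lookup (substitute u) e + lookup (substitute v) e      ≡⟨ lookup-+ᵛ (substitute u) (substitute v) e ⟨
    lookup (substitute u +ᵛ substitute v) e                ∎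
    where
    contribution-+ᵛ : ∀ e j → contribution (u +ᵛ v) e j ≡ contribution u e j + contribution v e j
    contribution-+ᵛ e j = trans (cong (_* lookup (M j) e) (lookup-+ᵛ u v j))
                                (*-distribʳ-+ (lookup (M j) e) (lookup u j) (lookup v j))

  substitute-0 : substitute (replicate t 0) ≡ replicate m 0
  substitute-0 = vec-ext λ e → begin
    lookup (substitute (replicate t 0)) e  ≡⟨ lookup-substitute (replicate t 0) e ⟩
    sum (contribution (replicate t 0) e)   ≡⟨ sum-cong-≗ (λ j → cong (_* lookup (M j) e) (lookup-replicate j 0)) ⟩
    sum {t} (λ _ → 0)                      ≡⟨ sum-replicate-zero t ⟩
    0                                      ≡⟨ lookup-replicate e 0 ⟨
    lookup (replicate m 0) e               ∎

  substitute-unit : ∀ j → substitute (unit j) ≡ M j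
  substitute-unit j = vec-ext λ e → begin
    lookup (substitute (unit j)) e      ≡⟨ lookup-substitute (unit j) e ⟩
    sum (contribution (unit j) e)       ≡⟨ sum-single (contribution (unit j) e) j
                                             (λ i i≢j → cong (_* lookup (M i) e) (lookup-unit-≢ i≢j)) ⟩
    lookup (unit j) j * lookup (M j) e  ≡⟨ cong (_* lookup (M j) e) (lookup-unit-≡ j) ⟩
    1 * lookup (M j) e                  ≡⟨ *-identityˡ _ ⟩
    lookup (M j) e                      ∎

  substitute-variableSum-^ᴾ : ∀ N → map substitute (variableSum t ^ᴾ N) ≡ List.tabulate M ^ᴾ N
  substitute-variableSum-^ᴾ N = begin
    map substitute (variableSum t ^ᴾ N)     ≡⟨ map-^ᴾ substitute substitute-+ᵛ substitute-0 (variableSum t) N ⟩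
    map substitute (variableSum t) ^ᴾ N     ≡⟨ cong (_^ᴾ N) (map-tabulate unit substitute) ⟩
    List.tabulate (substitute ∘ unit) ^ᴾ N  ≡⟨ cong (_^ᴾ N) (List-tabulate-cong substitute-unit) ⟩
    List.tabulate M ^ᴾ N                    ∎

  degree-substitute : ∀ c → degree (substitute c) ≡ sum (λ j → lookup c j * degree (M j))
  degree-substitute c = begin
    sum (lookup (substitute c))                 ≡⟨ sum-cong-≗ (lookup-substitute c) ⟩
    sum (λ e → sum (contribution c e))          ≡⟨ ∑-comm (contribution c) ⟩
    sum (λ j → sum (λ e → contribution c e j))  ≡⟨ sum-cong-≗ (λ j → *-distribˡ-sum (lookup c j) (lookup (M j))) ⟨
    sum (λ j → lookup c j * degree (M j))       ∎

lookup-edgeMonomial-≤1 : ∀ {m} (S : Subset m) e → lookup (edgeMonomial S) e ≤ 1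
lookup-edgeMonomial-≤1 S e with lookup S e | lookup∘tabulate (λ f → if lookup S f then 1 else 0) e
... | true  | eq = ≤-reflexive eq
... | false | eq = ≤-trans (≤-reflexive eq) z≤n

module _ {t m s} (T : Fin t → Subset m) (size≡1+s : ∀ j → degree (edgeMonomial (T j)) ≡ suc s) where

  private
    M = edgeMonomial ∘ T

  ∏!^[1+s]∣∏-factorials : ∀ c → ∏! c ^ suc s ∣ ∏ (λ e → lookup (substitute M c) e !)
  ∏!^[1+s]∣∏-factorials c = subst (_∣ ∏ (λ e → lookup (substitute M c) e !)) regroup (∏-mono-∣ factorials-at)
    where
    factorials-at : ∀ e → ∏ (λ j → (lookup c j !) ^ lookup (M j) e) ∣ lookup (substitute M c) e !
    factorials-at e = subst₂ _∣_
      (∏-cong {_} {λ j → (contribution M c e j) !} λ j → sym ([n!]^b≡[n*b]! (lookup c j) (lookup-edgeMonomial-≤1 (T j) e)))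
      (cong _! (sym (lookup-substitute M c e)))
      (∏!∣∑! (contribution M c e))
    regroup : ∏ (λ e → ∏ λ j → (lookup c j !) ^ lookup (M j) e) ≡ ∏! c ^ suc s
    regroup = begin
      ∏ (λ e → ∏ λ j → (lookup c j !) ^ lookup (M j) e)  ≡⟨ ∏-comm (λ e j → (lookup c j !) ^ lookup (M j) e) ⟩
      ∏ (λ j → ∏ λ e → (lookup c j !) ^ lookup (M j) e)  ≡⟨ ∏-cong (λ j → ∏-pow (lookup c j !) (lookup (M j))) ⟩
      ∏ (λ j → (lookup c j !) ^ degree (M j))            ≡⟨ ∏-cong (λ j → cong (lookup c j ! ^_) (size≡1+s j)) ⟩
      ∏ (λ j → (lookup c j !) ^ suc s)                   ≡⟨ ∏-^ (λ j → lookup c j !) (suc s) ⟩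
      ∏! c ^ suc s                                       ∎

  m≡k*[1+s] : ∀ k r .{{_ : NonZero r}} c → substitute M c ≡ replicate m r → degree c ≡ k * r → m ≡ k * suc s
  m≡k*[1+s] k r c c↦r deg≡kr = *-cancelʳ-≡ m (k * suc s) r (begin
    m * r                                  ≡⟨ degree-replicate m r ⟨
    degree (replicate m r)                 ≡⟨ cong degree c↦r ⟨
    degree (substitute M c)                ≡⟨ degree-substitute M c ⟩
    sum (λ j → lookup c j * degree (M j))  ≡⟨ sum-cong-≗ (λ j → cong (lookup c j *_) (size≡1+s j)) ⟩
    sum (λ j → lookup c j * suc s)         ≡⟨ *-distribʳ-sum (suc s) (lookup c) ⟨
    degree c * suc s                       ≡⟨ cong (_* suc s) deg≡kr ⟩
    k * r * suc s                          ≡⟨ xy∙z≈xz∙y k r (suc s) ⟩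
    k * suc s * r                          ∎)

  ∏!∣[r!]^k : ∀ k r .{{_ : NonZero r}} c → substitute M c ≡ replicate m r → degree c ≡ k * r → ∏! c ∣ (r !) ^ k
  ∏!∣[r!]^k k r c c↦r deg≡kr = m^[1+n]∣o^[1+n]⇒m∣o s (∏! c) ((r !) ^ k)
    (subst (∏! c ^ suc s ∣_) ∏-factorials≡ (∏!^[1+s]∣∏-factorials c))
    where
    ∏-factorials≡ : ∏ (λ e → lookup (substitute M c) e !) ≡ ((r !) ^ k) ^ suc s
    ∏-factorials≡ = begin
      ∏ (λ e → lookup (substitute M c) e !)  ≡⟨ ∏-cong (λ e → cong (λ v → lookup v e !) c↦r) ⟩
      ∏ (λ e → lookup (replicate m r) e !)   ≡⟨ ∏-cong {m} {λ e → lookup (replicate m r) e !}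
                                                   (λ e → cong _! (lookup-replicate e r)) ⟩
      ∏ {m} (λ _ → r !)                      ≡⟨ ∏-const m (r !) ⟩
      (r !) ^ m                              ≡⟨ cong (r ! ^_) (m≡k*[1+s] k r c c↦r deg≡kr) ⟩
      (r !) ^ (k * suc s)                    ≡⟨ ^-*-assoc (r !) k (suc s) ⟨
      ((r !) ^ k) ^ suc s                    ∎

  multinomialQuot∣coeff : ∀ k r .{{_ : NonZero r}} →
                          multinomialQuot k r ∣ coeff (replicate m r) (List.tabulate M ^ᴾ (k * r))
  multinomialQuot∣coeff k r = subst (λ p → multinomialQuot k r ∣ coeff (replicate m r) p)
    (substitute-variableSum-^ᴾ M (k * r))
    (coeff-map-∣ (substitute M) (replicate m r) (variableSum t ^ᴾ (k * r)) divides-fibre)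
    where
    divides-fibre : ∀ c → substitute M c ≡ replicate m r → multinomialQuot k r ∣ coeff c (variableSum t ^ᴾ (k * r))
    divides-fibre c c↦r with degree c ℕ.≟ k * r
    ... | no  deg≢kr = subst (_ ∣_) (sym (multinomial-≢ (k * r) c deg≢kr)) (_ ∣0)
    ... | yes deg≡kr = m*n≡o*p⇒n∣p⇒o∣m {{m^n≢0 (r !) k {{r !≢0}}}}
      (trans (multinomial (k * r) c deg≡kr) (sym (multinomialQuot*[r!]^k≡[k*r]! k r)))
      (∏!∣[r!]^k k r c c↦r deg≡kr)

-- Spanning trees have n − 1 edges

edges : ∀ {m} → Subset m → List (Fin m)
edges []          = []
edges (true  ∷ T) = zero ∷ map suc (edges T)
edges (false ∷ T) = map suc (edges T)

length-edges : ∀ {m} (T : Subset m) → length (edges T) ≡ degree (edgeMonomial T)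
length-edges []          = refl
length-edges (true  ∷ T) = cong suc (trans (length-map suc (edges T)) (length-edges T))
length-edges (false ∷ T) = trans (length-map suc (edges T)) (length-edges T)

∈-edges⁻ : ∀ {m} (T : Subset m) {e} → e ∈ₗ edges T → e ∈ T
∈-edges⁻ (true ∷ T)  (here refl) = here
∈-edges⁻ (true ∷ T)  (there e∈)  with ∈-map⁻ suc e∈
... | _ , e′∈ , refl = there (∈-edges⁻ T e′∈)
∈-edges⁻ (false ∷ T) e∈          with ∈-map⁻ suc e∈
... | _ , e′∈ , refl = there (∈-edges⁻ T e′∈)

∈-edges⁺ : ∀ {m} (T : Subset m) {e} → e ∈ T → e ∈ₗ edges T
∈-edges⁺ (true ∷ T)  here         = here refl
∈-edges⁺ (true ∷ T)  (there e∈T)  = there (∈-map⁺ suc (∈-edges⁺ T e∈T))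
∈-edges⁺ (false ∷ T) (there e∈T)  = ∈-map⁺ suc (∈-edges⁺ T e∈T)

edges-unique : ∀ {m} (T : Subset m) → Unique (edges T)
edges-unique []          = []
edges-unique (true  ∷ T) = All.tabulate zero∉ ∷ map⁺ Fin.suc-injective (edges-unique T)
  where
  zero∉ : ∀ {e} → e ∈ₗ map suc (edges T) → zero ≢ e
  zero∉ e∈ refl with ∈-map⁻ suc e∈
  ... | _ , _ , ()
edges-unique (false ∷ T) = map⁺ Fin.suc-injective (edges-unique T)

∈-without : ∀ {m} {T : Subset m} {e f} → e ∈ T → e ≢ f → e ∈ T without f
∈-without {T = T} {e} {f} e∈T e≢f = lookup⇒[]= e (T without f)
  (trans (lookup∘tabulate _ e) (cong₂ _∧_ ([]=⇒lookup e∈T) (cong not e≟f≡false)))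
  where
  e≟f≡false : isYes (e ≟ f) ≡ false
  e≟f≡false = trans (isYes≗does (e ≟ f)) (dec-false (e ≟ f) e≢f)

relabel : ∀ {n} → Fin n → Fin n → Fin n → Fin n
relabel a b x with x ≟ a
... | yes _ = b
... | no  _ = x

relabel-≡ : ∀ {n} {a b x : Fin n} → x ≡ a → relabel a b x ≡ b
relabel-≡ {a = a} {x = x} x≡a with x ≟ a
... | yes _   = refl
... | no  x≢a = contradiction x≡a x≢a

relabel-≢ : ∀ {n} {a b x : Fin n} → x ≢ a → relabel a b x ≡ x
relabel-≢ {a = a} {x = x} x≢a with x ≟ a
... | yes x≡a = contradiction x≡a x≢a
... | no  _   = refl

relabel-target : ∀ {n} (a b : Fin n) → relabel a b b ≡ b
relabel-target a b with b ≟ a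
... | yes _ = refl
... | no  _ = refl

module _ {n m : ℕ} (G : Graph n m) where

  private
    src tgt : Fin m → Fin n
    src e = proj₁ (ends G e)
    tgt e = proj₂ (ends G e)

  Connected-trans : ∀ {S u v w} → Connected G S u v → Connected G S v w → Connected G S u w
  Connected-trans here             v~w = v~w
  Connected-trans (fwd e e∈ eq u~) v~w = fwd e e∈ eq (Connected-trans u~ v~w)
  Connected-trans (bwd e e∈ eq u~) v~w = bwd e e∈ eq (Connected-trans u~ v~w)

  -- Union–find along es: the classes of the labelling are the components of (V, es).
  labelling : List (Fin m) → Fin n → Fin n
  labelling []       = id
  labelling (e ∷ es) = relabel (labelling es (src e)) (labelling es (tgt e)) ∘ labelling es

  labelling-connected : ∀ {S} es → (∀ {e} → e ∈ₗ es → e ∈ S) →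
                        ∀ u v → labelling es u ≡ labelling es v → Connected G S u v
  labelling-connected []       es⊆S u v refl = here
  labelling-connected {S} (e ∷ es) es⊆S u v lu≡lv = cases (l u ≟ l (src e)) (l v ≟ l (src e))
    where
    l = labelling es
    e∈S = es⊆S (here refl)
    IH = labelling-connected es (es⊆S ∘ there)
    cases : Dec (l u ≡ l (src e)) → Dec (l v ≡ l (src e)) → Connected G S u v
    cases (yes u~s) (yes v~s) = IH u v (trans u~s (sym v~s))
    cases (yes u~s) (no  v≁s) = Connected-trans (IH u (src e) u~s) (fwd e e∈S refl (IH (tgt e) v
      (trans (sym (relabel-≡ u~s)) (trans lu≡lv (relabel-≢ v≁s)))))
    cases (no  u≁s) (yes v~s) = Connected-trans (IH u (tgt e)
      (trans (sym (relabel-≢ u≁s)) (trans lu≡lv (relabel-≡ v~s)))) (bwd e e∈S refl (IH (src e) v (sym v~s)))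
    cases (no  u≁s) (no  v≁s) = IH u v (trans (sym (relabel-≢ u≁s)) (trans lu≡lv (relabel-≢ v≁s)))

  labelling-edge : ∀ es {e} → e ∈ₗ es → labelling es (src e) ≡ labelling es (tgt e)
  labelling-edge (e ∷ es) (here refl) =
    trans (relabel-≡ {a = labelling es (src e)} refl)
          (sym (relabel-target (labelling es (src e)) (labelling es (tgt e))))
  labelling-edge (f ∷ es) (there e∈es) =
    cong (relabel (labelling es (src f)) (labelling es (tgt f))) (labelling-edge es e∈es)

  connected-labelling : ∀ {S} es → (∀ {e} → e ∈ S → e ∈ₗ es) →
                        ∀ {u v} → Connected G S u v → labelling es u ≡ labelling es v
  connected-labelling es S⊆es here                = refl
  connected-labelling es S⊆es (fwd e e∈S refl u~) =
    trans (labelling-edge es (S⊆es e∈S)) (connected-labelling es S⊆es u~)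
  connected-labelling es S⊆es (bwd e e∈S refl u~) =
    trans (sym (labelling-edge es (S⊆es e∈S))) (connected-labelling es S⊆es u~)

  imageSize : (Fin n → Fin n) → ℕ
  imageSize l = sum (λ x → indicator (any? λ w → l w ≟ x))

  imageSize-id : imageSize id ≡ n
  imageSize-id = trans (sum-cong-≗ {n} {λ x → indicator (any? λ w → w ≟ x)} λ x → indicator-yes (x , refl))
                       (trans (∑-const n 1) (*-identityʳ n))

  imageSize-const : ∀ l w₀ → (∀ w → l w ≡ l w₀) → imageSize l ≡ 1
  imageSize-const l w₀ l≡ =
    trans (sum-single _ (l w₀) λ x x≢ → indicator-no λ (w , lw≡x) → x≢ (trans (sym lw≡x) (l≡ w)))
          (indicator-yes (w₀ , refl))

  imageSize-relabel : ∀ l s t → l s ≢ l t → suc (imageSize (relabel (l s) (l t) ∘ l)) ≡ imageSize l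
  imageSize-relabel l s t ls≢lt = begin
    suc (imageSize l′)                             ≡⟨ +-comm 1 (imageSize l′) ⟩
    imageSize l′ + 1                               ≡⟨ cong (imageSize l′ +_) (indicator-yes (s , refl)) ⟨
    imageSize l′ + indicator (any? λ w → l w ≟ a)  ≡⟨ ∑-update _ _ a (λ _ x≢a → indicator-⇔ (image-≢ x≢a)) ⟩
    imageSize l + indicator (any? λ w → l′ w ≟ a)  ≡⟨ cong (imageSize l +_) (indicator-no a∉image′) ⟩
    imageSize l + 0                                ≡⟨ +-identityʳ (imageSize l) ⟩
    imageSize l                                    ∎
    where
    a = l s
    l′ = relabel a (l t) ∘ l
    a∉image′ : ¬ ∃ λ w → l′ w ≡ a
    a∉image′ (w , l′w≡a) with l w ≟ a
    ... | yes _    = ls≢lt (sym l′w≡a)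
    ... | no  lw≢a = lw≢a l′w≡a
    image-≢ : ∀ {x} → x ≢ a → (∃ λ w → l′ w ≡ x) ⇔ (∃ λ w → l w ≡ x)
    image-≢ {x} x≢a = mk⇔ to (λ (w , lw≡x) → w , trans (relabel-≢ (x≢a ∘ trans (sym lw≡x))) lw≡x)
      where
      to : (∃ λ w → l′ w ≡ x) → ∃ λ w → l w ≡ x
      to (w , l′w≡x) with l w ≟ a
      ... | yes _ = t , l′w≡x
      ... | no  _ = w , l′w≡x

  forest-imageSize : ∀ {T} → Acyclic G T → ∀ es → Unique es → (∀ {e} → e ∈ₗ es → e ∈ T) →
                     imageSize (labelling es) + length es ≡ n
  forest-imageSize acyclic []       _             _    = trans (+-identityʳ _) imageSize-id
  forest-imageSize acyclic (e ∷ es) (e∉es ∷ uniq) es⊆T = begin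
    imageSize (labelling (e ∷ es)) + suc (length es)  ≡⟨ +-suc _ (length es) ⟩
    suc (imageSize (labelling (e ∷ es))) + length es  ≡⟨ cong (_+ length es)
                                                            (imageSize-relabel (labelling es) (src e) (tgt e) separated) ⟩
    imageSize (labelling es) + length es              ≡⟨ forest-imageSize acyclic es uniq (es⊆T ∘ there) ⟩
    n                                                 ∎
    where
    separated : labelling es (src e) ≢ labelling es (tgt e)
    separated = acyclic e (es⊆T (here refl)) ∘ labelling-connected es
      (λ f∈es → ∈-without (es⊆T (there f∈es)) (All.lookup e∉es f∈es ∘ sym)) (src e) (tgt e)

  spanningTree-degree : ∀ {T} → 1 ≤ n → IsSpanningTree G T → suc (degree (edgeMonomial T)) ≡ n
  spanningTree-degree {T} 1≤n (connected , acyclic) = begin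
    suc (degree (edgeMonomial T))         ≡⟨ cong suc (length-edges T) ⟨
    1 + length es                         ≡⟨ cong (_+ length es) single-class ⟨
    imageSize (labelling es) + length es  ≡⟨ forest-imageSize acyclic es (edges-unique T) (∈-edges⁻ T) ⟩
    n                                     ∎
    where
    es = edges T
    w₀ = fromℕ< 1≤n
    single-class : imageSize (labelling es) ≡ 1
    single-class = imageSize-const (labelling es) w₀ λ w → connected-labelling es (∈-edges⁺ T) (connected w w₀)

lemma5p7 : (n m : ℕ) → (G : Graph n m) → 2 ≤ n → (k r : ℕ) → 1 ≤ k → 1 ≤ r →
           (ts : List (Subset m)) → EnumeratesSpanningTrees G ts →
           multinomialQuot k r ∣ coeff (replicate m r) (kirchhoff ts ^ᴾ (k * r))
lemma5p7 (suc (suc s)) m G _ k r@(suc _) _ _ ts (_ , ts⇔trees) =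
  subst (λ Ψ → multinomialQuot k r ∣ coeff (replicate m r) (Ψ ^ᴾ (k * r)))
        tabulate≡kirchhoff (multinomialQuot∣coeff T tree-size k r)
  where
  T = List.lookup ts
  tree-size : ∀ j → degree (edgeMonomial (T j)) ≡ suc s
  tree-size j = ℕ.suc-injective (spanningTree-degree G (s≤s z≤n) (Equivalence.to (ts⇔trees (T j)) (∈-lookup j)))
  tabulate≡kirchhoff : List.tabulate (edgeMonomial ∘ T) ≡ kirchhoff ts
  tabulate≡kirchhoff = trans (sym (map-tabulate T edgeMonomial)) (cong (map edgeMonomial) (tabulate-lookup ts))
lemma5p7 (suc (suc _)) _ _ _        _ zero _ () _ _
lemma5p7 1             _ _ (s≤s ()) _ _    _ _  _ _
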